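{- (Inversion principle) For every rule of the sequent calculus $\mathfrak S$ other than left and right weakening, with premises $S_1,\dots,S_k$ and conclusion $S$: if $S$ is valid then each $S_i$ ($1\le i\le k$) is valid.
   Context: Formulas are built from a denumerable set of propositional variables with binary $\wedge,\vee$, unary $\neg,\nabla$ and constants $\bot,\top$. $\mathbb{S}_6$ is the algebra with universe $\{0,\tfrac13,N,B,\tfrac23,1\}$, lattice order $0<\tfrac13<N<\tfrac23<1$, $\tfrac13<B<\tfrac23$, $N,B$ incomparable; $\neg$ swaps $0\leftrightarrow1$, $\tfrac13\leftrightarrow\tfrac23$, fixes $N,B$; $\nabla0=0$, $\nabla x=1$ for $x\ne0$; homomorphisms from formulas send $\bot\mapsto0,\top\mapsto1$. A sequent is $\Gamma\Rightarrow\Sigma$ with $\Gamma,\Sigma$ finite sets of formulas; it is valid iff $h(\bigwedge\Gamma)\le h(\bigvee\Sigma)$ for every homomorphism $h$ into $\mathbb{S}_6$ (empty conjunction $\top$, empty disjunction $\bot$). $\nabla\Sigma=\{\nabla\beta:\beta\in\Sigma\}$. The rules of $\mathfrak S$ (premises / conclusion): left weakening $\Gamma\Rightarrow\Sigma$ / $\Gamma,\alpha\Rightarrow\Sigma$; right weakening $\Gamma\Rightarrow\Sigma$ / $\Gamma\Rightarrow\Sigma,\alpha$; cut $\Gamma\Rightarrow\Sigma,\alpha$ and $\alpha,\Gamma\Rightarrow\Sigma$ / $\Gamma\Rightarrow\Sigma$; $(\wedge\Rightarrow)$ $\Gamma,\alpha,\beta\Rightarrow\Sigma$ / $\Gamma,\alpha\wedge\beta\Rightarrow\Sigma$;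 $(\Rightarrow\wedge)$ $\Gamma\Rightarrow\Sigma,\alpha$ and $\Gamma\Rightarrow\Sigma,\beta$ / $\Gamma\Rightarrow\Sigma,\alpha\wedge\beta$; $(\vee\Rightarrow)$ $\Gamma,\alpha\Rightarrow\Sigma$ and $\Gamma,\beta\Rightarrow\Sigma$ / $\Gamma,\alpha\vee\beta\Rightarrow\Sigma$; $(\Rightarrow\vee)$ $\Gamma\Rightarrow\Sigma,\alpha,\beta$ / $\Gamma\Rightarrow\Sigma,\alpha\vee\beta$; $(\neg)$ $\alpha\Rightarrow\beta$ / $\neg\beta\Rightarrow\neg\alpha$; $(\neg\neg\Rightarrow)$ $\Gamma,\alpha\Rightarrow\Sigma$ / $\Gamma,\neg\neg\alpha\Rightarrow\Sigma$; $(\Rightarrow\neg\neg)$ $\Gamma\Rightarrow\alpha,\Sigma$ / $\Gamma\Rightarrow\neg\neg\alpha,\Sigma$; $(\nabla)$ $\Gamma,\alpha\Rightarrow\nabla\Sigma$ / $\Gamma,\nabla\alpha\Rightarrow\nabla\Sigma$; $(\neg\nabla\Rightarrow)$ $\Gamma,\neg\nabla\alpha\Rightarrow\Sigma$ / $\Gamma,\nabla\neg\nabla\alpha\Rightarrow\Sigma$. -}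

module Defs where

open import Data.Nat using (ℕ)
open import Data.Bool using (Bool; true; false; T)
open import Data.List using (List; []; _∷_; map; foldr; [_])
open import Data.List.Relation.Unary.All using (All)

data Formula : Set where
  var      : ℕ → Formula
  _∧f_ _∨f_ : Formula → Formula → Formula
  ¬f ∇f    : Formula → Formula
  ⊥f ⊤f    : Formula

-- The algebra S6: 0 < 1/3 < N,B < 2/3 < 1, N and B incomparable
data S6 : Set where
  s0 s13 sN sB s23 s1 : S6

leq : S6 → S6 → Bool
leq s0  _   = true
leq _   s1  = true
leq s13 s0  = false
leq s13 _   = true
leq sN  sN  = true
leq sN  s23 = true
leq sN  _   = false
leq sB  sB  = true
leq sB  s23 = true
leq sB  _   = false
leq s23 s23 = true
leq s23 _   = false
leq s1  _   = false

_≤S_ : S6 → S6 → Set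
x ≤S y = T (leq x y)

meet : S6 → S6 → S6
meet s0  _   = s0
meet _   s0  = s0
meet s1  y   = y
meet x   s1  = x
meet s13 _   = s13
meet _   s13 = s13
meet s23 y   = y
meet x   s23 = x
meet sN  sN  = sN
meet sB  sB  = sB
meet sN  sB  = s13
meet sB  sN  = s13

join : S6 → S6 → S6
join s1  _   = s1
join _   s1  = s1
join s0  y   = y
join x   s0  = x
join s23 _   = s23
join _   s23 = s23
join s13 y   = y
join x   s13 = x
join sN  sN  = sN
join sB  sB  = sB
join sN  sB  = s23
join sB  sN  = s23

neg : S6 → S6
neg s0  = s1
neg s13 = s23
neg sN  = sN
neg sB  = sB
neg s23 = s13
neg s1  = s0

nab : S6 → S6
nab s0 = s0
nab _  = s1

-- Homomorphisms from the formula algebra into S6 are exactly the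
-- extensions of assignments ℕ → S6 of the variables.
eval : (ℕ → S6) → Formula → S6
eval v (var n)  = v n
eval v (a ∧f b) = meet (eval v a) (eval v b)
eval v (a ∨f b) = join (eval v a) (eval v b)
eval v (¬f a)   = neg (eval v a)
eval v (∇f a)   = nab (eval v a)
eval v ⊥f       = s0
eval v ⊤f       = s1

-- Sequents Γ ⇒ Σ (finite sets represented by lists; validity is
-- insensitive to order and repetition)
record Sequent : Set where
  constructor _⇒_
  field
    ante : List Formula
    succ : List Formula

bigMeet : (ℕ → S6) → List Formula → S6
bigMeet v = foldr (λ a r → meet (eval v a) r) s1

bigJoin : (ℕ → S6) → List Formula → S6
bigJoin v = foldr (λ a r → join (eval v a) r) s0

Valid : Sequent → Set
Valid (Γ ⇒ Σ) = (v : ℕ → S6) → bigMeet v Γ ≤S bigJoin v Σ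

∇L : List Formula → List Formula
∇L = map ∇f

data RuleName : Set where
  weakL weakR cut ∧L ∧R ∨L ∨R negR ¬¬L ¬¬R nabla ¬∇L : RuleName

-- Instance r prems concl : (prems / concl) is an instance of rule r.
-- "Γ , α" is rendered as α ∷ Γ, "Σ , α" as α ∷ Σ.
data Instance : RuleName → List Sequent → Sequent → Set where
  i-weakL : ∀ Γ Σ α → Instance weakL [ Γ ⇒ Σ ] ((α ∷ Γ) ⇒ Σ)
  i-weakR : ∀ Γ Σ α → Instance weakR [ Γ ⇒ Σ ] (Γ ⇒ (α ∷ Σ))
  i-cut   : ∀ Γ Σ α → Instance cut ((Γ ⇒ (α ∷ Σ)) ∷ ((α ∷ Γ) ⇒ Σ) ∷ []) (Γ ⇒ Σ)
  i-∧L    : ∀ Γ Σ α β → Instance ∧L [ (α ∷ β ∷ Γ) ⇒ Σ ] (((α ∧f β) ∷ Γ) ⇒ Σ)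
  i-∧R    : ∀ Γ Σ α β → Instance ∧R ((Γ ⇒ (α ∷ Σ)) ∷ (Γ ⇒ (β ∷ Σ)) ∷ []) (Γ ⇒ ((α ∧f β) ∷ Σ))
  i-∨L    : ∀ Γ Σ α β → Instance ∨L (((α ∷ Γ) ⇒ Σ) ∷ ((β ∷ Γ) ⇒ Σ) ∷ []) (((α ∨f β) ∷ Γ) ⇒ Σ)
  i-∨R    : ∀ Γ Σ α β → Instance ∨R [ Γ ⇒ (α ∷ β ∷ Σ) ] (Γ ⇒ ((α ∨f β) ∷ Σ))
  i-neg   : ∀ α β → Instance negR [ [ α ] ⇒ [ β ] ] ([ ¬f β ] ⇒ [ ¬f α ])
  i-¬¬L   : ∀ Γ Σ α → Instance ¬¬L [ (α ∷ Γ) ⇒ Σ ] ((¬f (¬f α) ∷ Γ) ⇒ Σ)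
  i-¬¬R   : ∀ Γ Σ α → Instance ¬¬R [ Γ ⇒ (α ∷ Σ) ] (Γ ⇒ (¬f (¬f α) ∷ Σ))
  i-nabla : ∀ Γ Σ α → Instance nabla [ (α ∷ Γ) ⇒ ∇L Σ ] ((∇f α ∷ Γ) ⇒ ∇L Σ)
  i-¬∇L   : ∀ Γ Σ α → Instance ¬∇L [ (¬f (∇f α) ∷ Γ) ⇒ Σ ] ((∇f (¬f (∇f α)) ∷ Γ) ⇒ Σ)

{-# OPTIONS --safe #-}
module Submission where

-- For each rule other than weakening, every premise has an antecedent evaluating below,
-- and a succedent evaluating above, those of the conclusion in every valuation:
-- this is lattice theory in S6 together with neg being an order-reflecting involution and
-- nab being inflationary (applied to ¬∇α for the rule ¬∇L).

open import Defs
open import Data.List using (List; []; _∷_; [_])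
open import Data.List.Membership.Propositional using (_∈_)
open import Data.List.Relation.Unary.Any using (here; there)
open import Data.List.Relation.Unary.All as All using (All; []; _∷_)
open import Relation.Binary.PropositionalEquality using (_≡_; _≢_; refl; sym; subst₂)
open import Relation.Nullary.Decidable using (Dec; T?; _→-dec_; map′; toWitness)
open import Relation.Unary using (Decidable)
open import Data.Empty using (⊥-elim)

_≤?_ : ∀ x y → Dec (x ≤S y)
x ≤? y = T? (leq x y)

elements : List S6
elements = s0 ∷ s13 ∷ sN ∷ sB ∷ s23 ∷ s1 ∷ []

∈-elements : ∀ x → x ∈ elements
∈-elements s0  = here refl
∈-elements s13 = there (here refl)
∈-elements sN  = there (there (here refl))
∈-elements sB  = there (there (there (here refl)))
∈-elements s23 = there (there (there (there (here refl))))
∈-elements s1  = there (there (there (there (there (here refl)))))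

∀? : {P : S6 → Set} → Decidable P → Dec (∀ x → P x)
∀? P? = map′ (λ ps x → All.lookup ps (∈-elements x))
             (λ p → All.tabulate (λ {x} _ → p x))
             (All.all? P? elements)

≤S-trans : ∀ {x y z} → x ≤S y → y ≤S z → x ≤S z
≤S-trans {x} {y} {z} =
  toWitness {a? = ∀? λ x → ∀? λ y → ∀? λ z → x ≤? y →-dec y ≤? z →-dec x ≤? z} _ x y z

≤S-reflexive : ∀ {x y} → x ≡ y → x ≤S y
≤S-reflexive {x} refl = toWitness {a? = ∀? λ x → x ≤? x} _ x

meet-monoˡ : ∀ x y z → x ≤S y → meet x z ≤S meet y z
meet-monoˡ = toWitness {a? = ∀? λ x → ∀? λ y → ∀? λ z → x ≤? y →-dec meet x z ≤? meet y z} _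

join-monoˡ : ∀ x y z → x ≤S y → join x z ≤S join y z
join-monoˡ = toWitness {a? = ∀? λ x → ∀? λ y → ∀? λ z → x ≤? y →-dec join x z ≤? join y z} _

meet≤ˡ : ∀ x y → meet x y ≤S x
meet≤ˡ = toWitness {a? = ∀? λ x → ∀? λ y → meet x y ≤? x} _

meet≤ʳ : ∀ x y → meet x y ≤S y
meet≤ʳ = toWitness {a? = ∀? λ x → ∀? λ y → meet x y ≤? y} _

≤joinˡ : ∀ x y → x ≤S join x y
≤joinˡ = toWitness {a? = ∀? λ x → ∀? λ y → x ≤? join x y} _

≤joinʳ : ∀ x y → y ≤S join x y
≤joinʳ = toWitness {a? = ∀? λ x → ∀? λ y → y ≤? join x y} _

meet-assoc-≤ : ∀ x y z → meet x (meet y z) ≤S meet (meet x y) z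
meet-assoc-≤ =
  toWitness {a? = ∀? λ x → ∀? λ y → ∀? λ z → meet x (meet y z) ≤? meet (meet x y) z} _

join-assoc-≤ : ∀ x y z → join (join x y) z ≤S join x (join y z)
join-assoc-≤ =
  toWitness {a? = ∀? λ x → ∀? λ y → ∀? λ z → join (join x y) z ≤? join x (join y z)} _

neg-reflects-≤ : ∀ x y → neg y ≤S neg x → x ≤S y
neg-reflects-≤ = toWitness {a? = ∀? λ x → ∀? λ y → neg y ≤? neg x →-dec x ≤? y} _

nab-inflationary : ∀ x → x ≤S nab x
nab-inflationary = toWitness {a? = ∀? λ x → x ≤? nab x} _

neg-involutive : ∀ x → neg (neg x) ≡ x
neg-involutive s0  = refl
neg-involutive s13 = refl
neg-involutive sN  = refl
neg-involutive sB  = refl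
neg-involutive s23 = refl
neg-involutive s1  = refl

meet-identityʳ : ∀ x → meet x s1 ≡ x
meet-identityʳ s0  = refl
meet-identityʳ s13 = refl
meet-identityʳ sN  = refl
meet-identityʳ sB  = refl
meet-identityʳ s23 = refl
meet-identityʳ s1  = refl

join-identityʳ : ∀ x → join x s0 ≡ x
join-identityʳ s0  = refl
join-identityʳ s13 = refl
join-identityʳ sN  = refl
join-identityʳ sB  = refl
join-identityʳ s23 = refl
join-identityʳ s1  = refl

Valid-antitoneˡ : ∀ Γ Γ′ Σ → (∀ v → bigMeet v Γ′ ≤S bigMeet v Γ) → Valid (Γ ⇒ Σ) → Valid (Γ′ ⇒ Σ)
Valid-antitoneˡ _ _ _ Γ′≤Γ ⊨Γ⇒Σ v = ≤S-trans (Γ′≤Γ v) (⊨Γ⇒Σ v)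

Valid-monotoneʳ : ∀ Γ Σ Σ′ → (∀ v → bigJoin v Σ ≤S bigJoin v Σ′) → Valid (Γ ⇒ Σ) → Valid (Γ ⇒ Σ′)
Valid-monotoneʳ _ _ _ Σ≤Σ′ ⊨Γ⇒Σ v = ≤S-trans (⊨Γ⇒Σ v) (Σ≤Σ′ v)

Valid-singleton⇒≤ : ∀ α β → Valid ([ α ] ⇒ [ β ]) → ∀ v → eval v α ≤S eval v β
Valid-singleton⇒≤ α β ⊨α⇒β v =
  subst₂ _≤S_ (meet-identityʳ (eval v α)) (join-identityʳ (eval v β)) (⊨α⇒β v)

≤⇒Valid-singleton : ∀ α β → (∀ v → eval v α ≤S eval v β) → Valid ([ α ] ⇒ [ β ])
≤⇒Valid-singleton α β α≤β v =
  subst₂ _≤S_ (sym (meet-identityʳ (eval v α))) (sym (join-identityʳ (eval v β))) (α≤β v)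

mainTheorem18 : (r : RuleName) → r ≢ weakL → r ≢ weakR →
                (prems : List Sequent) (concl : Sequent) →
                Instance r prems concl → Valid concl → All Valid prems
mainTheorem18 .weakL r≢weakL _ _ _ (i-weakL _ _ _) _ = ⊥-elim (r≢weakL refl)
mainTheorem18 .weakR _ r≢weakR _ _ (i-weakR _ _ _) _ = ⊥-elim (r≢weakR refl)
mainTheorem18 .cut _ _ _ _ (i-cut Γ Σ α) ⊨ =
    Valid-monotoneʳ Γ Σ (α ∷ Σ) (λ v → ≤joinʳ (eval v α) (bigJoin v Σ)) ⊨
  ∷ Valid-antitoneˡ Γ (α ∷ Γ) Σ (λ v → meet≤ʳ (eval v α) (bigMeet v Γ)) ⊨
  ∷ []
mainTheorem18 .∧L _ _ _ _ (i-∧L Γ Σ α β) ⊨ =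
    Valid-antitoneˡ (α ∧f β ∷ Γ) (α ∷ β ∷ Γ) Σ
      (λ v → meet-assoc-≤ (eval v α) (eval v β) (bigMeet v Γ)) ⊨
  ∷ []
mainTheorem18 .∧R _ _ _ _ (i-∧R Γ Σ α β) ⊨ =
    Valid-monotoneʳ Γ (α ∧f β ∷ Σ) (α ∷ Σ)
      (λ v → join-monoˡ _ _ (bigJoin v Σ) (meet≤ˡ (eval v α) (eval v β))) ⊨
  ∷ Valid-monotoneʳ Γ (α ∧f β ∷ Σ) (β ∷ Σ)
      (λ v → join-monoˡ _ _ (bigJoin v Σ) (meet≤ʳ (eval v α) (eval v β))) ⊨
  ∷ []
mainTheorem18 .∨L _ _ _ _ (i-∨L Γ Σ α β) ⊨ =
    Valid-antitoneˡ (α ∨f β ∷ Γ) (α ∷ Γ) Σ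
      (λ v → meet-monoˡ _ _ (bigMeet v Γ) (≤joinˡ (eval v α) (eval v β))) ⊨
  ∷ Valid-antitoneˡ (α ∨f β ∷ Γ) (β ∷ Γ) Σ
      (λ v → meet-monoˡ _ _ (bigMeet v Γ) (≤joinʳ (eval v α) (eval v β))) ⊨
  ∷ []
mainTheorem18 .∨R _ _ _ _ (i-∨R Γ Σ α β) ⊨ =
    Valid-monotoneʳ Γ (α ∨f β ∷ Σ) (α ∷ β ∷ Σ)
      (λ v → join-assoc-≤ (eval v α) (eval v β) (bigJoin v Σ)) ⊨
  ∷ []
mainTheorem18 .negR _ _ _ _ (i-neg α β) ⊨ =
    ≤⇒Valid-singleton α β
      (λ v → neg-reflects-≤ (eval v α) (eval v β) (Valid-singleton⇒≤ (¬f β) (¬f α) ⊨ v))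
  ∷ []
mainTheorem18 .¬¬L _ _ _ _ (i-¬¬L Γ Σ α) ⊨ =
    Valid-antitoneˡ (¬f (¬f α) ∷ Γ) (α ∷ Γ) Σ
      (λ v → meet-monoˡ _ _ (bigMeet v Γ) (≤S-reflexive (sym (neg-involutive (eval v α))))) ⊨
  ∷ []
mainTheorem18 .¬¬R _ _ _ _ (i-¬¬R Γ Σ α) ⊨ =
    Valid-monotoneʳ Γ (¬f (¬f α) ∷ Σ) (α ∷ Σ)
      (λ v → join-monoˡ _ _ (bigJoin v Σ) (≤S-reflexive (neg-involutive (eval v α)))) ⊨
  ∷ []
mainTheorem18 .nabla _ _ _ _ (i-nabla Γ Σ α) ⊨ =
    Valid-antitoneˡ (∇f α ∷ Γ) (α ∷ Γ) (∇L Σ)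
      (λ v → meet-monoˡ _ _ (bigMeet v Γ) (nab-inflationary (eval v α))) ⊨
  ∷ []
mainTheorem18 .¬∇L _ _ _ _ (i-¬∇L Γ Σ α) ⊨ =
    Valid-antitoneˡ (∇f (¬f (∇f α)) ∷ Γ) (¬f (∇f α) ∷ Γ) Σ
      (λ v → meet-monoˡ _ _ (bigMeet v Γ) (nab-inflationary (neg (nab (eval v α))))) ⊨
  ∷ []
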